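{- Let $A$ be a meet-complemented lattice in which $\Box a$ exists for every $a\in A$, and let $a,b\in A$. Then (i) $\Box(a\wedge b)\le\Box a\wedge\Box b$; (ii) $\Box a\vee\Box b\le\Box(a\vee b)$; (iii) $\Box(a\vee\neg b)\wedge b\le\Box a$; (iv) $\Box(a\vee b)\wedge\neg b\le\Box a$; (v) $\Box a\wedge\Box\neg a=0$; (vi) $\Box 0=0$; (vii) $\Box a=1$ if and only if $a=1$.
   Context: A meet-complemented lattice is a lattice $(A,\wedge,\vee)$, not necessarily distributive, such that for every $a\in A$ the element $\neg a=\max\{b\in A: a\wedge b\le c\text{ for all }c\in A\}$ exists; it is bounded, with least element $0$ and greatest element $1$. For $a\in A$, $\Box a$ denotes $\max\{b\in A: a\vee\neg b=1\}$, when it exists. -}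

module Defs where

open import Level using (Level; _⊔_)
open import Data.Product using (_×_)
open import Relation.Binary.Lattice.Bundles using (BoundedLattice)

module _ {c ℓ₁ ℓ₂ : Level} (L : BoundedLattice c ℓ₁ ℓ₂) where
  open BoundedLattice L

  IsMax : ∀ {p} → (Carrier → Set p) → Carrier → Set (c ⊔ ℓ₂ ⊔ p)
  IsMax P m = P m × (∀ b → P b → b ≤ m)

  IsMeetComplement : (Carrier → Carrier) → Set (c ⊔ ℓ₂)
  IsMeetComplement neg = ∀ a → IsMax (λ b → ∀ x → (a ∧ b) ≤ x) (neg a)

  IsBox : (Carrier → Carrier) → (Carrier → Carrier) → Set (c ⊔ ℓ₁ ⊔ ℓ₂)
  IsBox neg box = ∀ a → IsMax (λ b → (a ∨ neg b) ≈ ⊤) (box a)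

module Submission where

-- The lattice is not assumed distributive, so the proof uses only the two
-- universal properties at hand:
--   * ¬a is the greatest element b with a ∧ b ≤ ⊥, and
--   * □a is the greatest element b with a ∨ ¬b = ⊤.

open import Defs
open import Level using (Level)
open import Data.Product using (_×_; _,_; proj₁; proj₂)
open import Function.Bundles using (_⇔_; mk⇔)
open import Relation.Binary.Lattice.Bundles using (BoundedLattice)
import Relation.Binary.Lattice.Properties.JoinSemilattice as JoinSemilatticeProperties
import Relation.Binary.Lattice.Properties.MeetSemilattice as MeetSemilatticeProperties
import Relation.Binary.Reasoning.PartialOrder as PosetReasoning

module MeetComplemented {c ℓ₁ ℓ₂ : Level} (L : BoundedLattice c ℓ₁ ℓ₂)
  (neg : BoundedLattice.Carrier L → BoundedLattice.Carrier L)
  (isNeg : IsMeetComplement L neg) where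

  open BoundedLattice L
  open MeetSemilatticeProperties meetSemilattice using (∧-monotonic)
  open PosetReasoning poset

  ⊤≤⇒≈⊤ : ∀ {x} → ⊤ ≤ x → x ≈ ⊤
  ⊤≤⇒≈⊤ h = antisym (maximum _) h

  ≈⊤⇒⊤≤ : ∀ {x} → x ≈ ⊤ → ⊤ ≤ x
  ≈⊤⇒⊤≤ e = reflexive (Eq.sym e)

  ∧-neg≤⊥ : ∀ a → a ∧ neg a ≤ ⊥
  ∧-neg≤⊥ a = proj₁ (isNeg a) ⊥

  neg-greatest : ∀ {a b} → a ∧ b ≤ ⊥ → b ≤ neg a
  neg-greatest {a} {b} h = proj₂ (isNeg a) b (λ x → trans h (minimum x))

  neg-greatest′ : ∀ {a b} → a ∧ b ≤ ⊥ → a ≤ neg b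
  neg-greatest′ {a} {b} h = neg-greatest (trans (∧-greatest (x∧y≤y b a) (x∧y≤x b a)) h)

  neg-antitone : ∀ {x y} → x ≤ y → neg y ≤ neg x
  neg-antitone {x} {y} x≤y =
    neg-greatest (trans (∧-monotonic x≤y refl) (∧-neg≤⊥ y))

  ≤-double-neg : ∀ x → x ≤ neg (neg x)
  ≤-double-neg x = neg-greatest′ (∧-neg≤⊥ x)

  ≤-neg-self⇒≤⊥ : ∀ {z} → z ≤ neg z → z ≤ ⊥
  ≤-neg-self⇒≤⊥ {z} h = trans (∧-greatest refl h) (∧-neg≤⊥ z)

  neg-⊤≤⊥ : neg ⊤ ≤ ⊥
  neg-⊤≤⊥ = trans (∧-greatest (maximum _) refl) (∧-neg≤⊥ ⊤)

  -- If x and y together cover ⊤, their complements are disjoint: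
  -- both x and y lie below ¬(¬x ∧ ¬y), hence so does ⊤.
  cover⇒negs-disjoint : ∀ {x y} → ⊤ ≤ x ∨ y → neg x ∧ neg y ≤ ⊥
  cover⇒negs-disjoint {x} {y} h = ≤-neg-self⇒≤⊥ (begin
      z          ≤⟨ maximum z ⟩
      ⊤          ≤⟨ h ⟩
      x ∨ y      ≤⟨ ∨-least x≤¬z y≤¬z ⟩
      neg z      ∎)
    where
    z = neg x ∧ neg y
    x≤¬z : x ≤ neg z
    x≤¬z = neg-greatest′ (trans (∧-monotonic refl (x∧y≤x _ _)) (∧-neg≤⊥ x))
    y≤¬z : y ≤ neg z
    y≤¬z = neg-greatest′ (trans (∧-monotonic refl (x∧y≤y _ _)) (∧-neg≤⊥ y))

  -- If both x ∨ ¬d and ¬x ∨ ¬d cover ⊤, then d = ⊥: the first cover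
  -- forces d ≤ ¬¬x, and then the second one makes d disjoint from itself.
  covers⇒≤⊥ : ∀ {x d} → ⊤ ≤ x ∨ neg d → ⊤ ≤ neg x ∨ neg d → d ≤ ⊥
  covers⇒≤⊥ {x} {d} h₁ h₂ = begin
      d                           ≤⟨ ∧-greatest d≤¬¬x (≤-double-neg d) ⟩
      neg (neg x) ∧ neg (neg d)   ≤⟨ cover⇒negs-disjoint h₂ ⟩
      ⊥                           ∎
    where
    d≤¬¬x : d ≤ neg (neg x)
    d≤¬¬x = neg-greatest′ (trans (∧-greatest (x∧y≤y _ _) (trans (x∧y≤x _ _) (≤-double-neg d)))
                                 (cover⇒negs-disjoint h₁))

module Necessity {c ℓ₁ ℓ₂ : Level} (L : BoundedLattice c ℓ₁ ℓ₂)
  (neg : BoundedLattice.Carrier L → BoundedLattice.Carrier L)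
  (isNeg : IsMeetComplement L neg)
  (box : BoundedLattice.Carrier L → BoundedLattice.Carrier L)
  (isBox : IsBox L neg box) where

  open BoundedLattice L
  open JoinSemilatticeProperties joinSemilattice using (∨-monotonic)
  open MeetComplemented L neg isNeg
  open PosetReasoning poset

  box-cover : ∀ a → ⊤ ≤ a ∨ neg (box a)
  box-cover a = ≈⊤⇒⊤≤ (proj₁ (isBox a))

  box-greatest : ∀ {a b} → ⊤ ≤ a ∨ neg b → b ≤ box a
  box-greatest {a} {b} h = proj₂ (isBox a) b (⊤≤⇒≈⊤ h)

  box-monotone : ∀ {x y} → x ≤ y → box x ≤ box y
  box-monotone x≤y = box-greatest (trans (box-cover _) (∨-monotonic x≤y refl))

  box-∧ : ∀ a b → box (a ∧ b) ≤ box a ∧ box b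
  box-∧ a b = ∧-greatest (box-monotone (x∧y≤x a b)) (box-monotone (x∧y≤y a b))

  box-∨ : ∀ a b → box a ∨ box b ≤ box (a ∨ b)
  box-∨ a b = ∨-least (box-monotone (x≤x∨y a b)) (box-monotone (y≤x∨y a b))

  -- Weakening: a disjunct e of the argument can be traded for a conjunct d
  -- with e ≤ ¬d, since both e and ¬□(a ∨ e) lie below ¬(□(a ∨ e) ∧ d).
  box-∨-∧ : ∀ {a e d} → e ≤ neg d → box (a ∨ e) ∧ d ≤ box a
  box-∨-∧ {a} {e} {d} e≤¬d = box-greatest (begin
      ⊤                       ≤⟨ box-cover (a ∨ e) ⟩
      (a ∨ e) ∨ neg (box (a ∨ e))
        ≤⟨ ∨-least (∨-monotonic refl e≤¬m) (trans (neg-antitone (x∧y≤x _ _)) (y≤x∨y a _)) ⟩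
      a ∨ neg m               ∎)
    where
    m = box (a ∨ e) ∧ d
    e≤¬m : e ≤ neg m
    e≤¬m = trans e≤¬d (neg-antitone (x∧y≤y _ _))

  box-∨-neg : ∀ a b → box (a ∨ neg b) ∧ b ≤ box a
  box-∨-neg a b = box-∨-∧ refl

  box-∨-∧-neg : ∀ a b → box (a ∨ b) ∧ neg b ≤ box a
  box-∨-∧-neg a b = box-∨-∧ (≤-double-neg b)

  -- (v): d = □a ∧ □¬a lies below both □a and □¬a, so a ∨ ¬d and ¬a ∨ ¬d
  -- both cover ⊤, which forces d = ⊥.
  box-∧-box-neg : ∀ a → box a ∧ box (neg a) ≈ ⊥
  box-∧-box-neg a = antisym (covers⇒≤⊥ (cover a (x∧y≤x _ _)) (cover (neg a) (x∧y≤y _ _)))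
                            (minimum _)
    where
    cover : ∀ x → box a ∧ box (neg a) ≤ box x → ⊤ ≤ x ∨ neg (box a ∧ box (neg a))
    cover x d≤□x = trans (box-cover x) (∨-monotonic refl (neg-antitone d≤□x))

  -- (vi): ⊥ ∨ ¬□⊥ = ⊤ puts □⊥ below its own complement.
  box-⊥ : box ⊥ ≈ ⊥
  box-⊥ = antisym (≤-neg-self⇒≤⊥ (begin
      box ⊥                 ≤⟨ maximum _ ⟩
      ⊤                     ≤⟨ box-cover ⊥ ⟩
      ⊥ ∨ neg (box ⊥)       ≤⟨ ∨-least (minimum _) refl ⟩
      neg (box ⊥)           ∎))
    (minimum _)

  -- (vii), forwards: if □a = ⊤ then a ∨ ¬⊤ = ⊤, and ¬⊤ = ⊥.
  box≈⊤⇒≈⊤ : ∀ {a} → box a ≈ ⊤ → a ≈ ⊤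
  box≈⊤⇒≈⊤ {a} e = ⊤≤⇒≈⊤ (begin
      ⊤                     ≤⟨ box-cover a ⟩
      a ∨ neg (box a)       ≤⟨ ∨-least refl (trans (neg-antitone (≈⊤⇒⊤≤ e)) (trans neg-⊤≤⊥ (minimum a))) ⟩
      a                     ∎)

  -- (vii), backwards: if a = ⊤ then ⊤ itself satisfies a ∨ ¬⊤ = ⊤.
  ≈⊤⇒box≈⊤ : ∀ {a} → a ≈ ⊤ → box a ≈ ⊤
  ≈⊤⇒box≈⊤ e = ⊤≤⇒≈⊤ (box-greatest (trans (≈⊤⇒⊤≤ e) (x≤x∨y _ _)))

proposition2 : {c ℓ₁ ℓ₂ : Level} (L : BoundedLattice c ℓ₁ ℓ₂)
    → let open BoundedLattice L in
    (neg : Carrier → Carrier) → IsMeetComplement L neg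
    → (box : Carrier → Carrier) → IsBox L neg box
    → (a b : Carrier)
    → (box (a ∧ b) ≤ (box a ∧ box b))
    × ((box a ∨ box b) ≤ box (a ∨ b))
    × ((box (a ∨ neg b) ∧ b) ≤ box a)
    × ((box (a ∨ b) ∧ neg b) ≤ box a)
    × ((box a ∧ box (neg a)) ≈ ⊥)
    × (box ⊥ ≈ ⊥)
    × ((box a ≈ ⊤) ⇔ (a ≈ ⊤))
proposition2 L neg isNeg box isBox a b =
    box-∧ a b
  , box-∨ a b
  , box-∨-neg a b
  , box-∨-∧-neg a b
  , box-∧-box-neg a
  , box-⊥
  , mk⇔ box≈⊤⇒≈⊤ ≈⊤⇒box≈⊤
  where open Necessity L neg isNeg box isBox
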